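{- Let $a$ and $b$ be two cells on the left edge (column $0$) of an $n\times n$ board, with $a$ strictly above $b$, fix a closed knight's tour on the board, and suppose that $m=|C_{a,b}|\ge 122$. Then there are at least $(m-122)/2$ turns of the tour at cells of $\mathrm{crown}(a,b)$ that are not in column $0$.
   Context: Use coordinates in which a cell is a point $(x,y)$ with $x\in\{0,\dots,n-1\}$ its column (increasing to the right) and $y\in\{0,\dots,n-1\}$ its row (increasing upward); two cells are a knight move apart if their coordinates differ by $1$ in one coordinate and $2$ in the other. A closed knight's tour is a Hamiltonian cycle in the knight-move graph on the cells; a turn is a triple of cyclically consecutive cells $c_{k-1},c_k,c_{k+1}$ of the tour that are not collinear, and it is said to be at the cell $c_k$. For a cell $c$ in column $0$, define the directions $D_1=(1,2)$, $D_2=(2,1)$, $D_3=(2,-1)$, $D_4=(1,-2)$, and let $r_i(c)$ be the ray starting at $c$ in direction $D_i$. For rays $r$ from $a$ and $r'$ from $b$ that intersect, let $S(r,r')$ be the set of cells of the board lying on or below $r$ and on or above $r'$. Define $\mathrm{crown}(a,b)=S(r_2(a),r_1(b))\cup S(r_3(a),r_2(b))\cup S(r_4(a),r_3(b))$, and let $C_{a,b}$ be the set of cells in column $0$ between $a$ and $b$, inclusive. -}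

module Defs where

open import Data.Nat using (ℕ; zero; suc; _*_; _%_; _<_)
open import Data.Nat.DivMod using (m%n<n)
open import Data.Fin using (Fin; toℕ; fromℕ<)
open import Data.Integer as ℤ using (ℤ; +_; _-_; ∣_∣)
open import Data.Product using (_×_; _,_; proj₁; proj₂)
open import Data.Sum using (_⊎_)
open import Data.List using (List; length; filter; allFin; cartesianProduct)
open import Relation.Nullary using (¬_; Dec)
open import Relation.Nullary.Decidable using (_×-dec_; _⊎-dec_; ¬?)
open import Relation.Unary using (Pred; Decidable)
open import Relation.Binary.PropositionalEquality using (_≡_)
open import Function.Definitions using (Injective; Surjective)

-- A cell (x , y) of the n×n board: x = column (rightwards), y = row (upwards).
Cell : ℕ → Set
Cell n = Fin n × Fin n

col row : ∀ {n} → Cell n → ℤ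
col c = + toℕ (proj₁ c)
row c = + toℕ (proj₂ c)

KnightMove : ∀ {n} → Cell n → Cell n → Set
KnightMove c d =
  (∣ col d - col c ∣ ≡ 1 × ∣ row d - row c ∣ ≡ 2) ⊎
  (∣ col d - col c ∣ ≡ 2 × ∣ row d - row c ∣ ≡ 1)

Collinear : ∀ {n} → Cell n → Cell n → Cell n → Set
Collinear p q r =
  (col q ℤ.- col p) ℤ.* (row r ℤ.- row p) ≡ (row q ℤ.- row p) ℤ.* (col r ℤ.- col p)

collinear? : ∀ {n} (p q r : Cell n) → Dec (Collinear p q r)
collinear? p q r = _ ℤ.≟ _

shift : ∀ {N} → ℕ → Fin N → Fin N
shift {suc M} k i = fromℕ< (m%n<n (toℕ i Data.Nat.+ k) (suc M))

next prev : ∀ {N} → Fin N → Fin N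
next = shift 1
prev {suc M} = shift M

record ClosedKnightTour (n : ℕ) : Set where
  field
    cell     : Fin (n * n) → Cell n
    injective  : Injective _≡_ _≡_ cell
    surjective : Surjective _≡_ _≡_ cell
    moves    : ∀ i → KnightMove (cell i) (cell (next i))

IsTurn : ∀ {n} → ClosedKnightTour n → Fin (n * n) → Set
IsTurn T k = ¬ Collinear (cell (prev k)) (cell k) (cell (next k))
  where open ClosedKnightTour T

isTurn? : ∀ {n} (T : ClosedKnightTour n) → Decidable (IsTurn T)
isTurn? T k = ¬? (collinear? (cell (prev k)) (cell k) (cell (next k)))
  where open ClosedKnightTour T

D₁ D₂ D₃ D₄ : ℤ × ℤ
D₁ = + 1 , + 2
D₂ = + 2 , + 1
D₃ = + 2 , ℤ.- + 1
D₄ = + 1 , ℤ.- + 2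

-- cell p lies on or below the ray from c (in column 0) in direction D (dx > 0):
-- (p_y - c_y)·dx ≤ (p_x - c_x)·dy   (all board cells have x ≥ c_x = 0)
OnOrBelow OnOrAbove : ∀ {n} → Cell n → ℤ × ℤ → Cell n → Set
OnOrBelow c (dx , dy) p = (row p ℤ.- row c) ℤ.* dx ℤ.≤ (col p ℤ.- col c) ℤ.* dy
OnOrAbove c (dx , dy) p = (col p ℤ.- col c) ℤ.* dy ℤ.≤ (row p ℤ.- row c) ℤ.* dx

onOrBelow? : ∀ {n} (c : Cell n) (D : ℤ × ℤ) → Decidable (OnOrBelow c D)
onOrBelow? c (dx , dy) p = _ ℤ.≤? _
onOrAbove? : ∀ {n} (c : Cell n) (D : ℤ × ℤ) → Decidable (OnOrAbove c D)
onOrAbove? c (dx , dy) p = _ ℤ.≤? _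

S : ∀ {n} → Cell n → ℤ × ℤ → Cell n → ℤ × ℤ → Pred (Cell n) _
S a D b D' p = OnOrBelow a D p × OnOrAbove b D' p

S? : ∀ {n} (a : Cell n) D b D' → Decidable (S a D b D')
S? a D b D' p = onOrBelow? a D p ×-dec onOrAbove? b D' p

Crown : ∀ {n} → Cell n → Cell n → Pred (Cell n) _
Crown a b p = S a D₂ b D₁ p ⊎ S a D₃ b D₂ p ⊎ S a D₄ b D₃ p

crown? : ∀ {n} (a b : Cell n) → Decidable (Crown a b)
crown? a b p = S? a D₂ b D₁ p ⊎-dec (S? a D₃ b D₂ p ⊎-dec S? a D₄ b D₃ p)

InC : ∀ {n} → Cell n → Cell n → Pred (Cell n) _
InC a b p = col p ≡ + 0 × (row b ℤ.≤ row p × row p ℤ.≤ row a)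

inC? : ∀ {n} (a b : Cell n) → Decidable (InC a b)
inC? a b p = (col p ℤ.≟ + 0) ×-dec ((_ ℤ.≤? _) ×-dec (_ ℤ.≤? _))

allCells : ∀ n → List (Cell n)
allCells n = cartesianProduct (allFin n) (allFin n)

sizeC : ∀ {n} → Cell n → Cell n → ℕ
sizeC {n} a b = length (filter (inC? a b) (allCells n))

CrownTurn : ∀ {n} → ClosedKnightTour n → Cell n → Cell n → Pred (Fin (n * n)) _
CrownTurn T a b k =
  IsTurn T k × (Crown a b (ClosedKnightTour.cell T k) × ¬ (col (ClosedKnightTour.cell T k) ≡ + 0))

crownTurn? : ∀ {n} (T : ClosedKnightTour n) (a b : Cell n) → Decidable (CrownTurn T a b)
crownTurn? T a b k =
  isTurn? T k ×-dec (crown? a b (ClosedKnightTour.cell T k) ×-dec ¬? (col (ClosedKnightTour.cell T k) ℤ.≟ + 0))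

numCrownTurns : ∀ {n} → ClosedKnightTour n → Cell n → Cell n → ℕ
numCrownTurns {n} T a b = length (filter (crownTurn? T a b) (allFin (n * n)))

module Submission where

-- A cell c of C_{a,b} is entered and left by knight moves pointing right, in two distinct
-- directions among D₁, …, D₄. Following the tour from c along either of them, it runs
-- straight until its first turn. If that segment is short compared with the rows left
-- up to a and down to b, the turn lies in the crown and off column 0; a turn and a side
-- determine the segment and hence c, so such cells number at most twice the crown turns.
-- Every other cell is labelled by its pair of directions and its row modulo a period
-- depending on the pair (3, 5, 4, 2, 5 or 3). Two long-segment cells with the same label
-- would send segments crossing strictly inside one of them, where the tour is already
-- going straight, so the labels are distinct and there are at most 22 such cells.

open import Defs
open import Data.Empty using (⊥; ⊥-elim)
open import Data.Fin as Fin using (Fin; toℕ)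
open import Data.Fin.Properties using (toℕ-fromℕ<; toℕ-injective; toℕ<n; injective⇒≤)
open import Data.Integer as ℤ using (ℤ; +_; -[1+_]; 0ℤ; ∣_∣)
import Data.Integer.Properties as ℤP
open import Data.Integer.Tactic.RingSolver using () renaming (solve-∀ to ℤ-solve-∀)
open import Data.List using (List; []; _∷_; length; lookup; filter; map; _++_; concat; upTo; allFin)
open import Data.List.Membership.Propositional using (_∈_)
open import Data.List.Membership.Propositional.Properties
  using (∈-lookup; ∈-map⁺; ∈-++⁺ˡ; ∈-++⁺ʳ; ∈-concat⁺′; ∈-upTo⁺; ∈-filter⁺; ∈-filter⁻; ∈-allFin)
open import Data.List.Membership.Setoid.Properties using (index-injective)
open import Data.List.Properties using (length-++; length-map)
open import Data.List.Relation.Unary.All as All using (All; _∷_; all?)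
open import Data.List.Relation.Unary.AllPairs using (_∷_)
open import Data.List.Relation.Unary.Any using (index; here; there)
open import Data.List.Relation.Unary.Unique.Propositional using (Unique)
import Data.List.Relation.Unary.Unique.Propositional.Properties as Unique
open import Data.Maybe using (Maybe; just; nothing)
open import Data.Maybe.Properties using (just-injective)
open import Data.Nat using (ℕ; zero; suc; _+_; _*_; _∸_; _%_; _/_; _≤_; _<_; z≤n; s≤s; NonZero)
open import Data.Nat.DivMod using (m%n<n; m≡m%n+[m/n]*n; %-distribˡ-+; m%n%n≡m%n; [m+n]%n≡m%n; m<n⇒m%n≡m)
open import Data.Nat.Divisibility using (_∣_; divides; ∣⇒≤)
import Data.Nat.Properties as ℕP
open import Data.Nat.Tactic.RingSolver using () renaming (solve-∀ to ℕ-solve-∀)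
open import Data.Product using (_×_; _,_; proj₁; proj₂; Σ; ∃-syntax; map₁)
open import Data.Product.Properties using (≡-dec)
open import Data.Sum as Sum using (_⊎_; inj₁; inj₂)
open import Function using (_∘_; id)
open import Relation.Binary.Definitions using (Tri; tri<; tri≈; tri>)
open import Relation.Binary.PropositionalEquality
open import Relation.Nullary using (¬_; Dec; yes; no)
open import Relation.Nullary.Decidable using (¬?; _→-dec_; _⊎-dec_; toWitness; decidable-stable)
open import Relation.Unary using (Pred; Decidable)

private
  variable
    A B : Set
    n : ℕ
    p q r : Cell n

lookup-injective : ∀ {xs : List A} {i j} → Unique xs → lookup xs i ≡ lookup xs j → i ≡ j
lookup-injective {xs = _ ∷ _} {Fin.zero}  {Fin.zero}  _         _ = refl
lookup-injective {xs = _ ∷ _} {Fin.zero}  {Fin.suc j} (x∉ ∷ _)  e = ⊥-elim (All.lookup x∉ (∈-lookup j) e)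
lookup-injective {xs = _ ∷ _} {Fin.suc i} {Fin.zero}  (x∉ ∷ _)  e = ⊥-elim (All.lookup x∉ (∈-lookup i) (sym e))
lookup-injective {xs = _ ∷ _} {Fin.suc i} {Fin.suc j} (_ ∷ xs!) e = cong Fin.suc (lookup-injective xs! e)

length-≤-by-injection : (f : A → B) {xs : List A} {ys : List B} → Unique xs → (∀ {x} → x ∈ xs → f x ∈ ys) →
  (∀ {x y} → x ∈ xs → y ∈ xs → f x ≡ f y → x ≡ y) → length xs ≤ length ys
length-≤-by-injection {B = B} f {xs} {ys} xs! into inj = injective⇒≤ {f = position} position-injective
  where
  position : Fin (length xs) → Fin (length ys)
  position i = index (into (∈-lookup i))
  position-injective : ∀ {i j} → position i ≡ position j → i ≡ j
  position-injective {i} {j} e = lookup-injective xs!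
    (inj (∈-lookup i) (∈-lookup j) (index-injective (setoid B) (into (∈-lookup i)) (into (∈-lookup j)) e))

length-filter-partition : ∀ {A : Set} {ℓ} {P : Pred A ℓ} (P? : Decidable P) (xs : List A) →
  length xs ≡ length (filter P? xs) + length (filter (¬? ∘ P?) xs)
length-filter-partition P? [] = refl
length-filter-partition P? (x ∷ xs) with P? x
... | yes _ = cong suc (length-filter-partition P? xs)
... | no _  = trans (cong suc (length-filter-partition P? xs)) (sym (ℕP.+-suc _ _))

module FirstSatisfying {ℓ} {P : Pred ℕ ℓ} (P? : Decidable P) where

  first : ℕ → ℕ → ℕ
  first j zero = j
  first j (suc f) with P? j
  ... | yes _ = j
  ... | no _  = first (suc j) f

  first-≥ : ∀ j f → j ≤ first j f
  first-≥ j zero = ℕP.≤-refl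
  first-≥ j (suc f) with P? j
  ... | yes _ = ℕP.≤-refl
  ... | no _  = ℕP.<⇒≤ (first-≥ (suc j) f)

  first-minimal : ∀ j f {i} → j ≤ i → i < first j f → ¬ P i
  first-minimal j zero j≤i i<j = ⊥-elim (ℕP.≤⇒≯ j≤i i<j)
  first-minimal j (suc f) j≤i i<first with P? j
  ... | yes _ = ⊥-elim (ℕP.≤⇒≯ j≤i i<first)
  ... | no ¬Pj with ℕP.m≤n⇒m<n∨m≡n j≤i
  ...   | inj₁ j<i  = first-minimal (suc j) f j<i i<first
  ...   | inj₂ refl = ¬Pj

  first-found : ∀ j f → P (first j f) ⊎ first j f ≡ j + f
  first-found j zero = inj₂ (sym (ℕP.+-identityʳ j))
  first-found j (suc f) with P? j
  ... | yes Pj = inj₁ Pj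
  ... | no _ with first-found (suc j) f
  ...   | inj₁ found = inj₁ found
  ...   | inj₂ e     = inj₂ (trans e (sym (ℕP.+-suc j f)))

module _ {M : ℕ} where
  private
    N = suc M

  toℕ-shift : ∀ k (i : Fin N) → toℕ (shift k i) ≡ (toℕ i + k) % N
  toℕ-shift k i = toℕ-fromℕ< (m%n<n (toℕ i + k) N)

  shift-shift : ∀ k l (i : Fin N) → shift k (shift l i) ≡ shift (l + k) i
  shift-shift k l i = toℕ-injective (begin
    toℕ (shift k (shift l i))           ≡⟨ toℕ-shift k (shift l i) ⟩
    (toℕ (shift l i) + k) % N           ≡⟨ cong (λ x → (x + k) % N) (toℕ-shift l i) ⟩
    ((toℕ i + l) % N + k) % N           ≡⟨ %-distribˡ-+ ((toℕ i + l) % N) k N ⟩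
    ((toℕ i + l) % N % N + k % N) % N   ≡⟨ cong (λ x → (x + k % N) % N) (m%n%n≡m%n (toℕ i + l) N) ⟩
    ((toℕ i + l) % N + k % N) % N       ≡⟨ %-distribˡ-+ (toℕ i + l) k N ⟨
    (toℕ i + l + k) % N                 ≡⟨ cong (_% N) (ℕP.+-assoc (toℕ i) l k) ⟩
    (toℕ i + (l + k)) % N               ≡⟨ toℕ-shift (l + k) i ⟨
    toℕ (shift (l + k) i)               ∎)
    where open ≡-Reasoning

  shift-full : (i : Fin N) → shift N i ≡ i
  shift-full i = toℕ-injective (begin
    toℕ (shift N i)   ≡⟨ toℕ-shift N i ⟩
    (toℕ i + N) % N   ≡⟨ [m+n]%n≡m%n (toℕ i) N ⟩
    toℕ i % N         ≡⟨ m<n⇒m%n≡m (toℕ<n i) ⟩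
    toℕ i             ∎)
    where open ≡-Reasoning

  prev-next : (i : Fin N) → prev (next i) ≡ i
  prev-next i = trans (shift-shift M 1 i) (shift-full i)

  next-prev : (i : Fin N) → next (prev i) ≡ i
  next-prev i = trans (shift-shift 1 M i) (trans (cong (λ k → shift k i) (ℕP.+-comm M 1)) (shift-full i))

  shift-fixed⇒∣ : ∀ k (i : Fin N) → shift k i ≡ i → N ∣ k
  shift-fixed⇒∣ k i e = divides ((toℕ i + k) / N) (ℕP.+-cancelˡ-≡ (toℕ i) _ _ (begin
    toℕ i + k                                  ≡⟨ m≡m%n+[m/n]*n (toℕ i + k) N ⟩
    (toℕ i + k) % N + (toℕ i + k) / N * N      ≡⟨ cong (_+ (toℕ i + k) / N * N) (trans (sym (toℕ-shift k i)) (cong toℕ e)) ⟩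
    toℕ i + (toℕ i + k) / N * N                ∎))
    where open ≡-Reasoning

  next≢prev : 3 ≤ N → (i : Fin N) → next i ≢ prev i
  next≢prev 3≤N i e = ℕP.<⇒≱ 3≤N (∣⇒≤ (shift-fixed⇒∣ 2 i next²-fixed))
    where
    next²-fixed : shift 2 i ≡ i
    next²-fixed = trans (sym (shift-shift 1 1 i)) (trans (cong next e) (next-prev i))

%-equal⇒multiple-apart : ∀ d {m n} .{{_ : NonZero d}} → m % d ≡ n % d → m < n →
  ∃[ q ] 1 ≤ q × n ≡ m + d * q
%-equal⇒multiple-apart d {m} {n} m≡n[d] m<n = n/d ∸ m/d , ℕP.m<n⇒0<n∸m m/d<n/d , n≡m+dq
  where
  m/d = m / d
  n/d = n / d
  m≡ : m ≡ m % d + m/d * d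
  m≡ = m≡m%n+[m/n]*n m d
  n≡ : n ≡ m % d + n/d * d
  n≡ = trans (m≡m%n+[m/n]*n n d) (cong (_+ n/d * d) (sym m≡n[d]))
  m/d<n/d : m/d < n/d
  m/d<n/d = ℕP.≰⇒> λ n/d≤m/d → ℕP.<⇒≱ m<n (begin
    n                  ≡⟨ n≡ ⟩
    m % d + n/d * d    ≤⟨ ℕP.+-monoʳ-≤ (m % d) (ℕP.*-monoˡ-≤ d n/d≤m/d) ⟩
    m % d + m/d * d    ≡⟨ m≡ ⟨
    m                  ∎)
    where open ℕP.≤-Reasoning
  n≡m+dq : n ≡ m + d * (n/d ∸ m/d)
  n≡m+dq = begin
    n                                        ≡⟨ n≡ ⟩
    m % d + n/d * d                          ≡⟨ cong (λ x → m % d + x * d) (ℕP.m+[n∸m]≡n (ℕP.<⇒≤ m/d<n/d)) ⟨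
    m % d + (m/d + (n/d ∸ m/d)) * d          ≡⟨ +-*-rearrange (m % d) m/d (n/d ∸ m/d) d ⟩
    m % d + m/d * d + d * (n/d ∸ m/d)        ≡⟨ cong (_+ d * (n/d ∸ m/d)) m≡ ⟨
    m + d * (n/d ∸ m/d)                      ∎
    where
    open ≡-Reasoning
    +-*-rearrange : ∀ r a q d → r + (a + q) * d ≡ r + a * d + d * q
    +-*-rearrange = ℕ-solve-∀

-- Knight moves

data Dir : Set where
  dir₁ dir₂ dir₃ dir₄ : Dir

direction : Dir → ℤ × ℤ
direction dir₁ = D₁
direction dir₂ = D₂
direction dir₃ = D₃
direction dir₄ = D₄

dx dy : Dir → ℤ
dx d = proj₁ (direction d)
dy d = proj₂ (direction d)

data Move : Set where
  along against : Dir → Move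

private
  variable
    u v m : Move

opposite : ℤ × ℤ → ℤ × ℤ
opposite (x , y) = ℤ.- x , ℤ.- y

vector : Move → ℤ × ℤ
vector (along d)   = direction d
vector (against d) = opposite (direction d)

reverse : Move → Move
reverse (along d)   = against d
reverse (against d) = along d

fromVector : ℤ × ℤ → Maybe Move
fromVector (+ 1      , + 2)      = just (along dir₁)
fromVector (+ 2      , + 1)      = just (along dir₂)
fromVector (+ 2      , -[1+ 0 ]) = just (along dir₃)
fromVector (+ 1      , -[1+ 1 ]) = just (along dir₄)
fromVector (-[1+ 0 ] , -[1+ 1 ]) = just (against dir₁)
fromVector (-[1+ 1 ] , -[1+ 0 ]) = just (against dir₂)
fromVector (-[1+ 1 ] , + 1)      = just (against dir₃)
fromVector (-[1+ 0 ] , + 2)      = just (against dir₄)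
fromVector _                     = nothing

fromVector-vector : ∀ m → fromVector (vector m) ≡ just m
fromVector-vector (along dir₁)   = refl
fromVector-vector (along dir₂)   = refl
fromVector-vector (along dir₃)   = refl
fromVector-vector (along dir₄)   = refl
fromVector-vector (against dir₁) = refl
fromVector-vector (against dir₂) = refl
fromVector-vector (against dir₃) = refl
fromVector-vector (against dir₄) = refl

vector-injective : ∀ {u v} → vector u ≡ vector v → u ≡ v
vector-injective {u} {v} e =
  just-injective (trans (sym (fromVector-vector u)) (trans (cong fromVector e) (fromVector-vector v)))

vector-reverse : ∀ m → vector (reverse m) ≡ opposite (vector m)
vector-reverse (along d)   = refl
vector-reverse (against d) = cong₂ _,_ (sym (ℤP.neg-involutive (dx d))) (sym (ℤP.neg-involutive (dy d)))

allDirs : List Dir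
allDirs = dir₁ ∷ dir₂ ∷ dir₃ ∷ dir₄ ∷ []

∈-allDirs : ∀ d → d ∈ allDirs
∈-allDirs dir₁ = here refl
∈-allDirs dir₂ = there (here refl)
∈-allDirs dir₃ = there (there (here refl))
∈-allDirs dir₄ = there (there (there (here refl)))

allMoves : List Move
allMoves = map along allDirs ++ map against allDirs

∈-allMoves : ∀ m → m ∈ allMoves
∈-allMoves (along d)   = ∈-++⁺ˡ (∈-map⁺ along (∈-allDirs d))
∈-allMoves (against d) = ∈-++⁺ʳ (map along allDirs) (∈-map⁺ against (∈-allDirs d))

cross : ℤ × ℤ → ℤ × ℤ → ℤ
cross (x , y) (x′ , y′) = x ℤ.* y′ ℤ.- y ℤ.* x′

cross≡0⇒equal-or-reversed : ∀ u v → cross (vector u) (vector v) ≡ 0ℤ → v ≡ u ⊎ v ≡ reverse u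
cross≡0⇒equal-or-reversed u v cross≡0 =
  Sum.map vector-injective vector-injective (All.lookup (All.lookup checked (∈-allMoves u)) (∈-allMoves v) cross≡0)
  where
  _≟²_ = ≡-dec ℤ._≟_ ℤ._≟_
  EqualOrReversed : Move → Move → Set
  EqualOrReversed u v = cross (vector u) (vector v) ≡ 0ℤ → vector v ≡ vector u ⊎ vector v ≡ vector (reverse u)
  checked : All (λ u → All (EqualOrReversed u) allMoves) allMoves
  checked = toWitness {a? = all? (λ u → all? (λ v → (cross (vector u) (vector v) ℤ.≟ 0ℤ)
              →-dec ((vector v ≟² vector u) ⊎-dec (vector v ≟² vector (reverse u)))) allMoves) allMoves} _

displacement : Cell n → Cell n → ℤ × ℤ
displacement p q = col q ℤ.- col p , row q ℤ.- row p

record Step (m : Move) (p q : Cell n) : Set where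
  constructor step
  field
    displaced : displacement p q ≡ vector m
open Step

cell-≡ : col p ≡ col q → row p ≡ row q → p ≡ q
cell-≡ x≡ y≡ = cong₂ _,_ (toℕ-injective (ℤP.+-injective x≡)) (toℕ-injective (ℤP.+-injective y≡))

step-deterministic : Step m q r → Step m q p → r ≡ p
step-deterministic {q = q} sr sp = cell-≡ (cancel (col q) (cong proj₁ e)) (cancel (row q) (cong proj₂ e))
  where
  e = trans (displaced sr) (sym (displaced sp))
  cancel : ∀ z {x y} → x ℤ.- z ≡ y ℤ.- z → x ≡ y
  cancel z {x} {y} e = trans (restore x z) (trans (cong (ℤ._+ z) e) (sym (restore y z)))
    where
    restore : ∀ x z → x ≡ x ℤ.- z ℤ.+ z
    restore = ℤ-solve-∀

private
  ∣z∣≡1 : ∀ z → ∣ z ∣ ≡ 1 → z ≡ + 1 ⊎ z ≡ -[1+ 0 ]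
  ∣z∣≡1 (+ 1)      _ = inj₁ refl
  ∣z∣≡1 -[1+ 0 ]   _ = inj₂ refl
  ∣z∣≡1 (+ 0)      ()
  ∣z∣≡1 (+ suc (suc _)) ()
  ∣z∣≡1 -[1+ suc _ ] ()

  ∣z∣≡2 : ∀ z → ∣ z ∣ ≡ 2 → z ≡ + 2 ⊎ z ≡ -[1+ 1 ]
  ∣z∣≡2 (+ 2)      _ = inj₁ refl
  ∣z∣≡2 -[1+ 1 ]   _ = inj₂ refl
  ∣z∣≡2 (+ 0)      ()
  ∣z∣≡2 (+ 1)      ()
  ∣z∣≡2 (+ suc (suc (suc _))) ()
  ∣z∣≡2 -[1+ 0 ]   ()
  ∣z∣≡2 -[1+ suc (suc _) ] ()

knight-step : KnightMove p q → ∃[ m ] Step m p q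
knight-step (inj₁ (∣x∣≡1 , ∣y∣≡2)) with ∣z∣≡1 _ ∣x∣≡1 | ∣z∣≡2 _ ∣y∣≡2
... | inj₁ x≡ | inj₁ y≡ = along dir₁ , step (cong₂ _,_ x≡ y≡)
... | inj₁ x≡ | inj₂ y≡ = along dir₄ , step (cong₂ _,_ x≡ y≡)
... | inj₂ x≡ | inj₁ y≡ = against dir₄ , step (cong₂ _,_ x≡ y≡)
... | inj₂ x≡ | inj₂ y≡ = against dir₁ , step (cong₂ _,_ x≡ y≡)
knight-step (inj₂ (∣x∣≡2 , ∣y∣≡1)) with ∣z∣≡2 _ ∣x∣≡2 | ∣z∣≡1 _ ∣y∣≡1
... | inj₁ x≡ | inj₁ y≡ = along dir₂ , step (cong₂ _,_ x≡ y≡)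
... | inj₁ x≡ | inj₂ y≡ = along dir₃ , step (cong₂ _,_ x≡ y≡)
... | inj₂ x≡ | inj₁ y≡ = against dir₃ , step (cong₂ _,_ x≡ y≡)
... | inj₂ x≡ | inj₂ y≡ = against dir₂ , step (cong₂ _,_ x≡ y≡)

step-reverse : Step m p q → Step (reverse m) q p
step-reverse {m = m} {p = p} {q = q} (step displaced) = step (begin
  displacement q p                   ≡⟨ cong₂ _,_ (swap (col p) (col q)) (swap (row p) (row q)) ⟩
  opposite (displacement p q)        ≡⟨ cong opposite displaced ⟩
  opposite (vector m)                ≡⟨ vector-reverse m ⟨
  vector (reverse m)                 ∎)
  where
  open ≡-Reasoning
  swap : ∀ x y → x ℤ.- y ≡ ℤ.- (y ℤ.- x)
  swap = ℤ-solve-∀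

step-unique : Step u p q → Step v p q → u ≡ v
step-unique su sv = vector-injective (trans (sym (displaced su)) (displaced sv))

collinear-sym : Collinear p q r → Collinear r q p
collinear-sym {p = p} {q} {r} c = ℤP.i-j≡0⇒i≡j _ _ (begin
  (col q ℤ.- col r) ℤ.* (row p ℤ.- row r) ℤ.- (row q ℤ.- row r) ℤ.* (col p ℤ.- col r)
    ≡⟨ flip (col p) (row p) (col q) (row q) (col r) (row r) ⟩
  ℤ.- ((col q ℤ.- col p) ℤ.* (row r ℤ.- row p) ℤ.- (row q ℤ.- row p) ℤ.* (col r ℤ.- col p))
    ≡⟨ cong (λ z → ℤ.- (z ℤ.- (row q ℤ.- row p) ℤ.* (col r ℤ.- col p))) c ⟩
  ℤ.- ((row q ℤ.- row p) ℤ.* (col r ℤ.- col p) ℤ.- (row q ℤ.- row p) ℤ.* (col r ℤ.- col p))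
    ≡⟨ cong ℤ.-_ (ℤP.+-inverseʳ ((row q ℤ.- row p) ℤ.* (col r ℤ.- col p))) ⟩
  0ℤ ∎)
  where
  open ≡-Reasoning
  flip : ∀ px py qx qy rx ry →
    (qx ℤ.- rx) ℤ.* (py ℤ.- ry) ℤ.- (qy ℤ.- ry) ℤ.* (px ℤ.- rx)
      ≡ ℤ.- ((qx ℤ.- px) ℤ.* (ry ℤ.- py) ℤ.- (qy ℤ.- py) ℤ.* (rx ℤ.- px))
  flip = ℤ-solve-∀

collinear⇒cross≡0 : Collinear p q r → cross (displacement p q) (displacement q r) ≡ 0ℤ
collinear⇒cross≡0 {p = p} {q} {r} c = begin
  (col q ℤ.- col p) ℤ.* (row r ℤ.- row q) ℤ.- (row q ℤ.- row p) ℤ.* (col r ℤ.- col q)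
    ≡⟨ shift-base (col p) (row p) (col q) (row q) (col r) (row r) ⟩
  (col q ℤ.- col p) ℤ.* (row r ℤ.- row p) ℤ.- (row q ℤ.- row p) ℤ.* (col r ℤ.- col p)
    ≡⟨ cong (λ z → z ℤ.- (row q ℤ.- row p) ℤ.* (col r ℤ.- col p)) c ⟩
  (row q ℤ.- row p) ℤ.* (col r ℤ.- col p) ℤ.- (row q ℤ.- row p) ℤ.* (col r ℤ.- col p)
    ≡⟨ ℤP.+-inverseʳ ((row q ℤ.- row p) ℤ.* (col r ℤ.- col p)) ⟩
  0ℤ ∎
  where
  open ≡-Reasoning
  shift-base : ∀ px py qx qy rx ry →
    (qx ℤ.- px) ℤ.* (ry ℤ.- qy) ℤ.- (qy ℤ.- py) ℤ.* (rx ℤ.- qx)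
      ≡ (qx ℤ.- px) ℤ.* (ry ℤ.- py) ℤ.- (qy ℤ.- py) ℤ.* (rx ℤ.- px)
  shift-base = ℤ-solve-∀

straight : Step u p q → Step v q r → Collinear p q r → r ≢ p → v ≡ u
straight {u = u} {p = p} {q} {v = v} {r} su sv c r≢p = Sum.[ id , reversed ]′ (cross≡0⇒equal-or-reversed u v cross≡0)
  where
  cross≡0 : cross (vector u) (vector v) ≡ 0ℤ
  cross≡0 = subst₂ (λ x y → cross x y ≡ 0ℤ) (displaced su) (displaced sv) (collinear⇒cross≡0 {p = p} {q} {r} c)
  reversed : v ≡ reverse u → v ≡ u
  reversed refl = ⊥-elim (r≢p (step-deterministic sv (step-reverse su)))

heading : Move → Dir
heading (along d)   = d
heading (against d) = d

step-from-edge : col p ≡ + 0 → Step m p q → m ≡ along (heading m)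
step-from-edge {m = along d} _ _ = refl
step-from-edge {p = p} {m = against d} {q = q} p₀ (step displaced) =
  ⊥-elim (nonnegative d (trans (cong (λ x → col q ℤ.- x) (sym p₀)) (cong proj₁ displaced)))
  where
  nonnegative : ∀ d {x} → + x ℤ.- + 0 ≢ ℤ.- dx d
  nonnegative dir₁ ()
  nonnegative dir₂ ()
  nonnegative dir₃ ()
  nonnegative dir₄ ()

-- Rays and the crown

point : Cell n → ℤ × ℤ
point c = col c , row c

ray : Dir → ℤ → ℕ → ℤ × ℤ
ray d y j = + j ℤ.* dx d , y ℤ.+ + j ℤ.* dy d

≤-by-difference : ∀ {x y x′ y′ : ℤ} → x ℤ.- y ≡ x′ ℤ.- y′ → x′ ℤ.≤ y′ → x ℤ.≤ y
≤-by-difference e x′≤y′ = ℤP.i-j≤0⇒i≤j (subst (ℤ._≤ 0ℤ) (sym e) (ℤP.i≤j⇒i-j≤0 x′≤y′))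

scaled-cast : ∀ {k L m u} → k * L ≤ m * u → + L ℤ.* + k ℤ.≤ + u ℤ.* + m
scaled-cast {k} {L} {m} {u} h = subst₂ ℤ._≤_ (times-comm k L) (times-comm m u) (ℤ.+≤+ h)
  where
  times-comm : ∀ a b → + (a * b) ≡ + b ℤ.* + a
  times-comm a b = trans (ℤP.pos-* a b) (ℤP.*-comm (+ a) (+ b))

-- After L steps in direction d from (0 , y) one is on or below the ray from (0 , y + u) in
-- direction e as soon as L · (e × d) ≤ u · eₓ; k and m carry these constants as naturals.
below-ray : ∀ d e {a p : Cell n} {y} L u {k m} → dy d ℤ.* dx e ℤ.- dx d ℤ.* dy e ≡ + k → dx e ≡ + m →
  col a ≡ 0ℤ → row a ≡ y ℤ.+ + u → point p ≡ ray d y L → k * L ≤ m * u → OnOrBelow a (direction e) p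
below-ray d e {a} {p} {y} L u {k} {m} e₀ e₁ a₀ a↑ p≡ h = ≤-by-difference (begin
  difference (point p) (point a)
    ≡⟨ cong₂ difference p≡ (cong₂ _,_ a₀ a↑) ⟩
  difference (ray d y L) (0ℤ , y ℤ.+ + u)
    ≡⟨ identity (dx d) (dy d) (dx e) (dy e) y (+ L) (+ u) ⟩
  + L ℤ.* (dy d ℤ.* dx e ℤ.- dx d ℤ.* dy e) ℤ.- + u ℤ.* dx e ∎)
  (subst₂ (λ c x → + L ℤ.* c ℤ.≤ + u ℤ.* x) (sym e₀) (sym e₁) (scaled-cast {k} {L} {m} {u} h))
  where
  open ≡-Reasoning
  difference : ℤ × ℤ → ℤ × ℤ → ℤ
  difference (px , py) (ax , ay) = (py ℤ.- ay) ℤ.* dx e ℤ.- (px ℤ.- ax) ℤ.* dy e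
  identity : ∀ dx dy ex ey y L u →
    (y ℤ.+ L ℤ.* dy ℤ.- (y ℤ.+ u)) ℤ.* ex ℤ.- (L ℤ.* dx ℤ.- 0ℤ) ℤ.* ey
      ≡ L ℤ.* (dy ℤ.* ex ℤ.- dx ℤ.* ey) ℤ.- u ℤ.* ex
  identity = ℤ-solve-∀

above-ray : ∀ d e {b p : Cell n} L v {k m} → dx d ℤ.* dy e ℤ.- dy d ℤ.* dx e ≡ + k → dx e ≡ + m →
  col b ≡ 0ℤ → point p ≡ ray d (row b ℤ.+ + v) L → k * L ≤ m * v → OnOrAbove b (direction e) p
above-ray d e {b} {p} L v {k} {m} e₀ e₁ b₀ p≡ h = ≤-by-difference (begin
  difference (point p) (point b)
    ≡⟨ cong₂ difference p≡ (cong (_, row b) b₀) ⟩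
  difference (ray d (row b ℤ.+ + v) L) (0ℤ , row b)
    ≡⟨ identity (dx d) (dy d) (dx e) (dy e) (row b) (+ L) (+ v) ⟩
  + L ℤ.* (dx d ℤ.* dy e ℤ.- dy d ℤ.* dx e) ℤ.- + v ℤ.* dx e ∎)
  (subst₂ (λ c x → + L ℤ.* c ℤ.≤ + v ℤ.* x) (sym e₀) (sym e₁) (scaled-cast {k} {L} {m} {v} h))
  where
  open ≡-Reasoning
  difference : ℤ × ℤ → ℤ × ℤ → ℤ
  difference (px , py) (bx , by) = (px ℤ.- bx) ℤ.* dy e ℤ.- (py ℤ.- by) ℤ.* dx e
  identity : ∀ dx dy ex ey by L v →
    (L ℤ.* dx ℤ.- 0ℤ) ℤ.* ey ℤ.- (by ℤ.+ v ℤ.+ L ℤ.* dy ℤ.- by) ℤ.* ex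
      ≡ L ℤ.* (dx ℤ.* ey ℤ.- dy ℤ.* ex) ℤ.- v ℤ.* ex
  identity = ℤ-solve-∀

-- UpRoom and DownRoom are the below-ray and above-ray conditions for the sector of the
-- crown reached by a segment in direction d, with coefficients k = |d × e| and m = eₓ.
UpRoom DownRoom : Dir → (L room : ℕ) → Set
UpRoom dir₁ L up = 3 * L ≤ 2 * up
UpRoom dir₂ L up = 4 * L ≤ 2 * up
UpRoom dir₃ L up = 3 * L ≤ 1 * up
UpRoom dir₄ L up = ⊥
DownRoom dir₁ L down = ⊥
DownRoom dir₂ L down = 3 * L ≤ 1 * down
DownRoom dir₃ L down = 4 * L ≤ 2 * down
DownRoom dir₄ L down = 3 * L ≤ 2 * down

upRoom? : ∀ d L room → Dec (UpRoom d L room)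
upRoom? dir₁ L up = 3 * L ℕP.≤? 2 * up
upRoom? dir₂ L up = 4 * L ℕP.≤? 2 * up
upRoom? dir₃ L up = 3 * L ℕP.≤? 1 * up
upRoom? dir₄ L up = no λ ()
downRoom? : ∀ d L room → Dec (DownRoom d L room)
downRoom? dir₁ L down = no λ ()
downRoom? dir₂ L down = 3 * L ℕP.≤? 1 * down
downRoom? dir₃ L down = 4 * L ℕP.≤? 2 * down
downRoom? dir₄ L down = 3 * L ℕP.≤? 2 * down

Short : Dir → (L up down : ℕ) → Set
Short d L up down = UpRoom d L up ⊎ DownRoom d L down

short? : ∀ d L up down → Dec (Short d L up down)
short? d L up down = upRoom? d L up ⊎-dec downRoom? d L down

short⇒crown : ∀ d {a b p : Cell n} {L up down} → col a ≡ 0ℤ → col b ≡ 0ℤ →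
  row a ≡ row b ℤ.+ + down ℤ.+ + up → point p ≡ ray d (row b ℤ.+ + down) L →
  Short d L up down → Crown a b p
short⇒crown dir₁ {b = b} {L = L} {up} {down} a₀ b₀ a↑ p≡ (inj₁ h) = inj₁
  ( below-ray dir₁ dir₂ {y = row b ℤ.+ + down} L up refl refl a₀ a↑ p≡ h
  , above-ray dir₁ dir₁ L down refl refl b₀ p≡ z≤n)
short⇒crown dir₂ {b = b} {L = L} {up} {down} a₀ b₀ a↑ p≡ (inj₁ h) = inj₂ (inj₁
  ( below-ray dir₂ dir₃ {y = row b ℤ.+ + down} L up refl refl a₀ a↑ p≡ h
  , above-ray dir₂ dir₂ L down refl refl b₀ p≡ z≤n))
short⇒crown dir₂ {b = b} {L = L} {up} {down} a₀ b₀ a↑ p≡ (inj₂ h) = inj₁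
  ( below-ray dir₂ dir₂ {y = row b ℤ.+ + down} L up refl refl a₀ a↑ p≡ z≤n
  , above-ray dir₂ dir₁ L down refl refl b₀ p≡ h)
short⇒crown dir₃ {b = b} {L = L} {up} {down} a₀ b₀ a↑ p≡ (inj₁ h) = inj₂ (inj₂
  ( below-ray dir₃ dir₄ {y = row b ℤ.+ + down} L up refl refl a₀ a↑ p≡ h
  , above-ray dir₃ dir₃ L down refl refl b₀ p≡ z≤n))
short⇒crown dir₃ {b = b} {L = L} {up} {down} a₀ b₀ a↑ p≡ (inj₂ h) = inj₂ (inj₁
  ( below-ray dir₃ dir₃ {y = row b ℤ.+ + down} L up refl refl a₀ a↑ p≡ z≤n
  , above-ray dir₃ dir₂ L down refl refl b₀ p≡ h))
short⇒crown dir₄ {b = b} {L = L} {up} {down} a₀ b₀ a↑ p≡ (inj₂ h) = inj₂ (inj₂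
  ( below-ray dir₄ dir₄ {y = row b ℤ.+ + down} L up refl refl a₀ a↑ p≡ z≤n
  , above-ray dir₄ dir₃ L down refl refl b₀ p≡ h))

-- Crossing rays

scaled-≤ : ∀ k m {L α q M} r → L ≤ α * q → k * α ≤ m * M → k * L ≤ m * (M * q + r)
scaled-≤ k m {L} {α} {q} {M} r L≤αq kα≤mM = begin
  k * L             ≤⟨ ℕP.*-monoʳ-≤ k L≤αq ⟩
  k * (α * q)       ≡⟨ ℕP.*-assoc k α q ⟨
  k * α * q         ≤⟨ ℕP.*-monoˡ-≤ q kα≤mM ⟩
  m * M * q         ≡⟨ ℕP.*-assoc m M q ⟩
  m * (M * q)       ≤⟨ ℕP.*-monoʳ-≤ m (ℕP.m≤m+n (M * q) r) ⟩
  m * (M * q + r)   ∎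
  where open ℕP.≤-Reasoning

upRoom-scaled : ∀ d {α M L} q r → UpRoom d α M → L ≤ α * q → UpRoom d L (M * q + r)
upRoom-scaled dir₁ {α} {M} {L} q r room L≤ = scaled-≤ 3 2 {L} {α} {q} {M} r L≤ room
upRoom-scaled dir₂ {α} {M} {L} q r room L≤ = scaled-≤ 4 2 {L} {α} {q} {M} r L≤ room
upRoom-scaled dir₃ {α} {M} {L} q r room L≤ = scaled-≤ 3 1 {L} {α} {q} {M} r L≤ room

downRoom-scaled : ∀ d {α M L} q r → DownRoom d α M → L ≤ α * q → DownRoom d L (M * q + r)
downRoom-scaled dir₂ {α} {M} {L} q r room L≤ = scaled-≤ 3 1 {L} {α} {q} {M} r L≤ room
downRoom-scaled dir₃ {α} {M} {L} q r room L≤ = scaled-≤ 4 2 {L} {α} {q} {M} r L≤ room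
downRoom-scaled dir₄ {α} {M} {L} q r room L≤ = scaled-≤ 3 2 {L} {α} {q} {M} r L≤ room

-- Two column-0 cells whose rows differ by period * q send rays, in direction lo from the
-- lower cell and hi from the upper one, that meet after lowerSteps * q and upperSteps * q
-- steps respectively; the room conditions make any shorter segment Short.
record Crossing (lo hi : Dir) : Set where
  field
    period lowerSteps upperSteps : ℕ
    ⦃ period≢0 ⦄ : NonZero period
    lowerSteps≥1 : 1 ≤ lowerSteps
    upperSteps≥1 : 1 ≤ upperSteps
    meet-x : + lowerSteps ℤ.* dx lo ≡ + upperSteps ℤ.* dx hi
    meet-y : + lowerSteps ℤ.* dy lo ≡ + period ℤ.+ + upperSteps ℤ.* dy hi
    lower-room : UpRoom lo lowerSteps period
    upper-room : DownRoom hi upperSteps period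

data DirPair : Set where
  pair₁₂ pair₁₃ pair₁₄ pair₂₃ pair₂₄ pair₃₄ : DirPair

lower upper : DirPair → Dir
lower pair₁₂ = dir₁
lower pair₁₃ = dir₁
lower pair₁₄ = dir₁
lower pair₂₃ = dir₂
lower pair₂₄ = dir₂
lower pair₃₄ = dir₃
upper pair₁₂ = dir₂
upper pair₁₃ = dir₃
upper pair₁₄ = dir₄
upper pair₂₃ = dir₃
upper pair₂₄ = dir₄
upper pair₃₄ = dir₄

lower≢upper : ∀ pr → lower pr ≢ upper pr
lower≢upper pair₁₂ ()
lower≢upper pair₁₃ ()
lower≢upper pair₁₄ ()
lower≢upper pair₂₃ ()
lower≢upper pair₂₄ ()
lower≢upper pair₃₄ ()

crossing : ∀ pr → Crossing (lower pr) (upper pr)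
crossing pair₁₂ = record { period = 3 ; lowerSteps = 2 ; upperSteps = 1 ; lowerSteps≥1 = s≤s z≤n
  ; upperSteps≥1 = s≤s z≤n ; meet-x = refl ; meet-y = refl ; lower-room = ℕP.≤ᵇ⇒≤ _ _ _ ; upper-room = ℕP.≤ᵇ⇒≤ _ _ _ }
crossing pair₁₃ = record { period = 5 ; lowerSteps = 2 ; upperSteps = 1 ; lowerSteps≥1 = s≤s z≤n
  ; upperSteps≥1 = s≤s z≤n ; meet-x = refl ; meet-y = refl ; lower-room = ℕP.≤ᵇ⇒≤ _ _ _ ; upper-room = ℕP.≤ᵇ⇒≤ _ _ _ }
crossing pair₁₄ = record { period = 4 ; lowerSteps = 1 ; upperSteps = 1 ; lowerSteps≥1 = s≤s z≤n
  ; upperSteps≥1 = s≤s z≤n ; meet-x = refl ; meet-y = refl ; lower-room = ℕP.≤ᵇ⇒≤ _ _ _ ; upper-room = ℕP.≤ᵇ⇒≤ _ _ _ }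
crossing pair₂₃ = record { period = 2 ; lowerSteps = 1 ; upperSteps = 1 ; lowerSteps≥1 = s≤s z≤n
  ; upperSteps≥1 = s≤s z≤n ; meet-x = refl ; meet-y = refl ; lower-room = ℕP.≤ᵇ⇒≤ _ _ _ ; upper-room = ℕP.≤ᵇ⇒≤ _ _ _ }
crossing pair₂₄ = record { period = 5 ; lowerSteps = 1 ; upperSteps = 2 ; lowerSteps≥1 = s≤s z≤n
  ; upperSteps≥1 = s≤s z≤n ; meet-x = refl ; meet-y = refl ; lower-room = ℕP.≤ᵇ⇒≤ _ _ _ ; upper-room = ℕP.≤ᵇ⇒≤ _ _ _ }
crossing pair₃₄ = record { period = 3 ; lowerSteps = 1 ; upperSteps = 2 ; lowerSteps≥1 = s≤s z≤n
  ; upperSteps≥1 = s≤s z≤n ; meet-x = refl ; meet-y = refl ; lower-room = ℕP.≤ᵇ⇒≤ _ _ _ ; upper-room = ℕP.≤ᵇ⇒≤ _ _ _ }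

module _ {lo hi} (X : Crossing lo hi) where
  open Crossing X

  rays-meet : ∀ y q → ray lo y (lowerSteps * q) ≡ ray hi (y ℤ.+ + (period * q)) (upperSteps * q)
  rays-meet y q = cong₂ _,_ meet-col meet-row
    where
    open ≡-Reasoning
    Q = + q
    meet-col : + (lowerSteps * q) ℤ.* dx lo ≡ + (upperSteps * q) ℤ.* dx hi
    meet-col = begin
      + (lowerSteps * q) ℤ.* dx lo        ≡⟨ cong (ℤ._* dx lo) (ℤP.pos-* lowerSteps q) ⟩
      + lowerSteps ℤ.* Q ℤ.* dx lo        ≡⟨ regroup (+ lowerSteps) Q (dx lo) ⟩
      Q ℤ.* (+ lowerSteps ℤ.* dx lo)      ≡⟨ cong (Q ℤ.*_) meet-x ⟩
      Q ℤ.* (+ upperSteps ℤ.* dx hi)      ≡⟨ regroup (+ upperSteps) Q (dx hi) ⟨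
      + upperSteps ℤ.* Q ℤ.* dx hi        ≡⟨ cong (ℤ._* dx hi) (ℤP.pos-* upperSteps q) ⟨
      + (upperSteps * q) ℤ.* dx hi        ∎
      where
      regroup : ∀ a q d → a ℤ.* q ℤ.* d ≡ q ℤ.* (a ℤ.* d)
      regroup = ℤ-solve-∀
    meet-row : y ℤ.+ + (lowerSteps * q) ℤ.* dy lo ≡ y ℤ.+ + (period * q) ℤ.+ + (upperSteps * q) ℤ.* dy hi
    meet-row = begin
      y ℤ.+ + (lowerSteps * q) ℤ.* dy lo
        ≡⟨ cong (λ z → y ℤ.+ z ℤ.* dy lo) (ℤP.pos-* lowerSteps q) ⟩
      y ℤ.+ + lowerSteps ℤ.* Q ℤ.* dy lo
        ≡⟨ regroup y (+ lowerSteps) Q (dy lo) ⟩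
      y ℤ.+ Q ℤ.* (+ lowerSteps ℤ.* dy lo)
        ≡⟨ cong (λ z → y ℤ.+ Q ℤ.* z) meet-y ⟩
      y ℤ.+ Q ℤ.* (+ period ℤ.+ + upperSteps ℤ.* dy hi)
        ≡⟨ spread y Q (+ period) (+ upperSteps) (dy hi) ⟩
      y ℤ.+ + period ℤ.* Q ℤ.+ + upperSteps ℤ.* Q ℤ.* dy hi
        ≡⟨ cong₂ (λ u v → y ℤ.+ u ℤ.+ v ℤ.* dy hi) (ℤP.pos-* period q) (ℤP.pos-* upperSteps q) ⟨
      y ℤ.+ + (period * q) ℤ.+ + (upperSteps * q) ℤ.* dy hi ∎
      where
      regroup : ∀ y a q d → y ℤ.+ a ℤ.* q ℤ.* d ≡ y ℤ.+ q ℤ.* (a ℤ.* d)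
      regroup = ℤ-solve-∀
      spread : ∀ y q m b d → y ℤ.+ q ℤ.* (m ℤ.+ b ℤ.* d) ≡ y ℤ.+ m ℤ.* q ℤ.+ b ℤ.* q ℤ.* d
      spread = ℤ-solve-∀

  meeting-within-segments : ∀ {q L L′ up′ down} → 1 ≤ q →
    ¬ Short lo L (period * q + up′) down → ¬ Short hi L′ up′ (period * q + down) →
    1 ≤ lowerSteps * q × lowerSteps * q < L × 1 ≤ upperSteps * q × upperSteps * q ≤ L′
  meeting-within-segments {q} {L} {L′} {up′} {down} 1≤q lower-long upper-long =
      ℕP.*-mono-≤ lowerSteps≥1 1≤q
    , ℕP.≰⇒> (λ L≤ → lower-long (inj₁ (upRoom-scaled lo q up′ lower-room L≤)))
    , ℕP.*-mono-≤ upperSteps≥1 1≤q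
    , ℕP.≮⇒≥ (λ L′< → upper-long (inj₂ (downRoom-scaled hi q down upper-room (ℕP.<⇒≤ L′<))))

Sorted : DirPair → Dir → Dir → Set
Sorted pr d d′ = (lower pr ≡ d × upper pr ≡ d′) ⊎ (lower pr ≡ d′ × upper pr ≡ d)

private
  classify : ∀ d d′ → d ≡ d′ ⊎ Σ DirPair λ pr → Sorted pr d d′
  classify dir₁ dir₁ = inj₁ refl
  classify dir₁ dir₂ = inj₂ (pair₁₂ , inj₁ (refl , refl))
  classify dir₁ dir₃ = inj₂ (pair₁₃ , inj₁ (refl , refl))
  classify dir₁ dir₄ = inj₂ (pair₁₄ , inj₁ (refl , refl))
  classify dir₂ dir₁ = inj₂ (pair₁₂ , inj₂ (refl , refl))
  classify dir₂ dir₂ = inj₁ refl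
  classify dir₂ dir₃ = inj₂ (pair₂₃ , inj₁ (refl , refl))
  classify dir₂ dir₄ = inj₂ (pair₂₄ , inj₁ (refl , refl))
  classify dir₃ dir₁ = inj₂ (pair₁₃ , inj₂ (refl , refl))
  classify dir₃ dir₂ = inj₂ (pair₂₃ , inj₂ (refl , refl))
  classify dir₃ dir₃ = inj₁ refl
  classify dir₃ dir₄ = inj₂ (pair₃₄ , inj₁ (refl , refl))
  classify dir₄ dir₁ = inj₂ (pair₁₄ , inj₂ (refl , refl))
  classify dir₄ dir₂ = inj₂ (pair₂₄ , inj₂ (refl , refl))
  classify dir₄ dir₃ = inj₂ (pair₃₄ , inj₂ (refl , refl))
  classify dir₄ dir₄ = inj₁ refl

pairOf : Dir → Dir → DirPair
pairOf d d′ = Sum.[ (λ _ → pair₁₂) , proj₁ ]′ (classify d d′)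

pairOf-sorted : ∀ d d′ → d ≢ d′ → Sorted (pairOf d d′) d d′
pairOf-sorted d d′ d≢d′ = sorted (classify d d′)
  where
  sorted : (r : d ≡ d′ ⊎ Σ DirPair λ pr → Sorted pr d d′) → Sorted (Sum.[ (λ _ → pair₁₂) , proj₁ ]′ r) d d′
  sorted (inj₁ d≡d′)        = ⊥-elim (d≢d′ d≡d′)
  sorted (inj₂ (_ , sorts)) = sorts

sorted-lower : ∀ {pr d d′} → Sorted pr d d′ → lower pr ≡ d ⊎ lower pr ≡ d′
sorted-lower = Sum.map proj₁ proj₁

sorted-upper : ∀ {pr d d′} → Sorted pr d d′ → upper pr ≡ d′ ⊎ upper pr ≡ d
sorted-upper = Sum.map proj₂ proj₂

pairPeriod : DirPair → ℕ
pairPeriod pr = Crossing.period (crossing pr)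

residue : DirPair → ℕ → ℕ
residue pr y = _%_ y (pairPeriod pr) ⦃ Crossing.period≢0 (crossing pr) ⦄

residue< : ∀ pr y → residue pr y < pairPeriod pr
residue< pr y = m%n<n y (pairPeriod pr) ⦃ Crossing.period≢0 (crossing pr) ⦄

same-residue⇒apart : ∀ pr {y y′} → residue pr y ≡ residue pr y′ → y < y′ →
  ∃[ q ] 1 ≤ q × y′ ≡ y + pairPeriod pr * q
same-residue⇒apart pr = %-equal⇒multiple-apart (pairPeriod pr) ⦃ Crossing.period≢0 (crossing pr) ⦄

allPairs : List DirPair
allPairs = pair₁₂ ∷ pair₁₃ ∷ pair₁₄ ∷ pair₂₃ ∷ pair₂₄ ∷ pair₃₄ ∷ []

∈-allPairs : ∀ pr → pr ∈ allPairs
∈-allPairs pair₁₂ = here refl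
∈-allPairs pair₁₃ = there (here refl)
∈-allPairs pair₁₄ = there (there (here refl))
∈-allPairs pair₂₃ = there (there (there (here refl)))
∈-allPairs pair₂₄ = there (there (there (there (here refl))))
∈-allPairs pair₃₄ = there (there (there (there (there (here refl)))))

residuesOf : DirPair → List (DirPair × ℕ)
residuesOf pr = map (pr ,_) (upTo (pairPeriod pr))

residueCodes : List (DirPair × ℕ)
residueCodes = concat (map residuesOf allPairs)

∈-residueCodes : ∀ pr {r} → r < pairPeriod pr → (pr , r) ∈ residueCodes
∈-residueCodes pr r< = ∈-concat⁺′ (∈-map⁺ (pr ,_) (∈-upTo⁺ r<)) (∈-map⁺ residuesOf (∈-allPairs pr))

length-residueCodes : length residueCodes ≡ 22
length-residueCodes = refl

-- Straight segments of the tour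

data Side : Set where
  forwards backwards : Side

module _ {M : ℕ} where
  private
    N = suc M

  advance retreat : Side → Fin N → Fin N
  advance forwards  = next
  advance backwards = prev
  retreat forwards  = prev
  retreat backwards = next

  retreat-advance : ∀ s (i : Fin N) → retreat s (advance s i) ≡ i
  retreat-advance forwards  = prev-next
  retreat-advance backwards = next-prev

  walk : Side → Fin N → ℕ → Fin N
  walk s i zero    = i
  walk s i (suc j) = advance s (walk s i j)

  walk-injective : ∀ s {i i′ : Fin N} j → walk s i j ≡ walk s i′ j → i ≡ i′
  walk-injective s zero    e = e
  walk-injective s {i} {i′} (suc j) e = walk-injective s j (begin
    walk s i j                        ≡⟨ retreat-advance s (walk s i j) ⟨
    retreat s (walk s i (suc j))      ≡⟨ cong (retreat s) e ⟩
    retreat s (walk s i′ (suc j))     ≡⟨ retreat-advance s (walk s i′ j) ⟩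
    walk s i′ j                       ∎)
    where open ≡-Reasoning

translate : ℤ × ℤ → ℤ × ℤ → ℤ × ℤ
translate (x , y) (a , b) = x ℤ.+ a , y ℤ.+ b

step-point : Step m p q → point q ≡ translate (point p) (vector m)
step-point {p = p} {q = q} (step displaced) =
  cong₂ _,_ (add-back (col q) (col p) (cong proj₁ displaced)) (add-back (row q) (row p) (cong proj₂ displaced))
  where
  add-back : ∀ x y {z} → x ℤ.- y ≡ z → x ≡ y ℤ.+ z
  add-back x y refl = restore x y
    where
    restore : ∀ x y → x ≡ y ℤ.+ (x ℤ.- y)
    restore = ℤ-solve-∀

ray-zero : ∀ d y → ray d y 0 ≡ (0ℤ , y)
ray-zero d y = cong (0ℤ ,_) (ℤP.+-identityʳ y)

ray-suc : ∀ d y j → ray d y (suc j) ≡ translate (ray d y j) (direction d)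
ray-suc d y j = cong₂ _,_ (one-more (+ j) (dx d))
  (trans (cong (λ z → y ℤ.+ z) (one-more (+ j) (dy d))) (reassoc y (+ j ℤ.* dy d) (dy d)))
  where
  one-more : ∀ j x → (+ 1 ℤ.+ j) ℤ.* x ≡ j ℤ.* x ℤ.+ x
  one-more = ℤ-solve-∀
  reassoc : ∀ y a b → y ℤ.+ (a ℤ.+ b) ≡ y ℤ.+ a ℤ.+ b
  reassoc = ℤ-solve-∀

run : Dir → ℕ
run d = ∣ dx d ∣

ray-col : ∀ d y j → proj₁ (ray d y j) ≡ + (j * run d)
ray-col dir₁ y j = sym (ℤP.pos-* j 1)
ray-col dir₂ y j = sym (ℤP.pos-* j 2)
ray-col dir₃ y j = sym (ℤP.pos-* j 2)
ray-col dir₄ y j = sym (ℤP.pos-* j 1)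

ray-col-injective : ∀ d {y y′ j j′} → proj₁ (ray d y j) ≡ proj₁ (ray d y′ j′) → j ≡ j′
ray-col-injective d {y} {y′} {j} {j′} e = cancel d (ℤP.+-injective (trans (sym (ray-col d y j)) (trans e (ray-col d y′ j′))))
  where
  cancel : ∀ d → j * run d ≡ j′ * run d → j ≡ j′
  cancel dir₁ = ℕP.*-cancelʳ-≡ j j′ 1
  cancel dir₂ = ℕP.*-cancelʳ-≡ j j′ 2
  cancel dir₃ = ℕP.*-cancelʳ-≡ j j′ 2
  cancel dir₄ = ℕP.*-cancelʳ-≡ j j′ 1

ray-col-≥ : ∀ d y j → j ≤ ∣ proj₁ (ray d y j) ∣
ray-col-≥ d y j = subst (j ≤_) (cong ∣_∣ (sym (ray-col d y j))) (ℕP.m≤m*n j (run d) ⦃ run-nonZero d ⦄)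
  where
  run-nonZero : ∀ d → NonZero (run d)
  run-nonZero dir₁ = _
  run-nonZero dir₂ = _
  run-nonZero dir₃ = _
  run-nonZero dir₄ = _

along-injective : ∀ {d d′} → along d ≡ along d′ → d ≡ d′
along-injective refl = refl

along≢against : ∀ {d d′} → along d ≢ against d′
along≢against ()

module Segments {k} (T : ClosedKnightTour (suc k)) (3≤N : 3 ≤ suc k * suc k) where
  open ClosedKnightTour T

  tourStep : ∀ s w → ∃[ m ] Step m (cell w) (cell (advance s w))
  tourStep forwards  w = knight-step (moves w)
  tourStep backwards w = backwards-step (knight-step (moves (prev w)))
    where
    backwards-step : ∃[ m ] Step m (cell (prev w)) (cell (next (prev w))) → ∃[ m ] Step m (cell w) (cell (prev w))
    backwards-step (m , st) = reverse m , step-reverse (subst (λ z → Step m (cell (prev w)) (cell z)) (next-prev w) st)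

  ends-differ : ∀ s w → cell (advance s w) ≢ cell (retreat s w)
  ends-differ forwards  w e = next≢prev 3≤N w (injective e)
  ends-differ backwards w e = next≢prev 3≤N w (injective (sym e))

  collinear-around : ∀ s w → ¬ IsTurn T w → Collinear (cell (retreat s w)) (cell w) (cell (advance s w))
  collinear-around forwards  w ¬turn = decidable-stable (collinear? (cell (prev w)) (cell w) (cell (next w))) ¬turn
  collinear-around backwards w ¬turn =
    collinear-sym {p = cell (prev w)} {cell w} {cell (next w)} (collinear-around forwards w ¬turn)

  straight-through : ∀ s w → ¬ IsTurn T w →
    Step m (cell (retreat s w)) (cell w) → Step m (cell w) (cell (advance s w))
  straight-through s w ¬turn arrive =
    subst (λ m → Step m (cell w) (cell (advance s w))) (straight arrive leave (collinear-around s w ¬turn) (ends-differ s w)) leave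
    where
    leave = proj₂ (tourStep s w)

  arrival-direction : ∀ s s′ w {d d′} →
    Step (along d) (cell (retreat s w)) (cell w) → Step (along d) (cell w) (cell (advance s w)) →
    Step (along d′) (cell (retreat s′ w)) (cell w) → d ≡ d′
  arrival-direction forwards  forwards  w arrive _     arrive′ = along-injective (step-unique arrive arrive′)
  arrival-direction backwards backwards w arrive _     arrive′ = along-injective (step-unique arrive arrive′)
  arrival-direction forwards  backwards w _      leave arrive′ = ⊥-elim (along≢against (step-unique arrive′ (step-reverse leave)))
  arrival-direction backwards forwards  w _      leave arrive′ = ⊥-elim (along≢against (step-unique arrive′ (step-reverse leave)))

  heading-from : Side → Fin (suc k * suc k) → Dir
  heading-from s i = heading (proj₁ (tourStep s i))

  segmentLength : Side → Fin (suc k * suc k) → ℕ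
  segmentLength s i = FirstSatisfying.first (λ j → isTurn? T (walk s i j)) 1 (suc k)

  module _ (s : Side) (i : Fin (suc k * suc k)) (edge : col (cell i) ≡ 0ℤ) where
    private
      d = heading-from s i
      L = segmentLength s i
      open FirstSatisfying (λ j → isTurn? T (walk s i j))

    segment-step : ∀ j → j < L → Step (along d) (cell (walk s i j)) (cell (walk s i (suc j)))
    segment-step zero    _   = subst (λ m → Step m (cell i) (cell (advance s i)))
                                     (step-from-edge edge (proj₂ (tourStep s i))) (proj₂ (tourStep s i))
    segment-step (suc j) j<L = straight-through s (walk s i (suc j))
      (first-minimal 1 (suc k) (s≤s z≤n) j<L)
      (subst (λ w → Step (along d) (cell w) (cell (walk s i (suc j)))) (sym (retreat-advance s (walk s i j)))
        (segment-step j (ℕP.<-trans (ℕP.n<1+n j) j<L)))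

    segment-arrival : ∀ j → 1 ≤ j → j ≤ L → Step (along d) (cell (retreat s (walk s i j))) (cell (walk s i j))
    segment-arrival (suc j) _ j<L =
      subst (λ w → Step (along d) (cell w) (cell (walk s i (suc j)))) (sym (retreat-advance s (walk s i j)))
        (segment-step j j<L)

    segment-point : ∀ j → j ≤ L → point (cell (walk s i j)) ≡ ray d (row (cell i)) j
    segment-point zero    _   = trans (cong (_, row (cell i)) edge) (sym (ray-zero d (row (cell i))))
    segment-point (suc j) j<L = begin
      point (cell (walk s i (suc j)))                      ≡⟨ step-point (segment-step j j<L) ⟩
      translate (point (cell (walk s i j))) (direction d)  ≡⟨ cong (λ x → translate x (direction d)) (segment-point j (ℕP.<⇒≤ j<L)) ⟩
      translate (ray d (row (cell i)) j) (direction d)     ≡⟨ ray-suc d (row (cell i)) j ⟨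
      ray d (row (cell i)) (suc j)                         ∎
      where open ≡-Reasoning

    segment-length≥1 : 1 ≤ L
    segment-length≥1 = first-≥ 1 (suc k)

    -- The search for a turn cannot run off the board: k + 1 straight steps leave every column.
    segment-ends-at-turn : IsTurn T (walk s i L)
    segment-ends-at-turn = Sum.[ id , (λ L≡2+k → ⊥-elim (off-board L≡2+k)) ]′ (first-found 1 (suc k))
      where
      off-board : L ≡ 1 + suc k → ⊥
      off-board L≡2+k = ℕP.<⇒≱ (toℕ<n (proj₁ (cell w))) (begin
        suc k                                        ≤⟨ ray-col-≥ d (row (cell i)) (suc k) ⟩
        ∣ proj₁ (ray d (row (cell i)) (suc k)) ∣     ≡⟨ cong (∣_∣ ∘ proj₁) (segment-point (suc k) k+1≤L) ⟨
        toℕ (proj₁ (cell w))                         ∎)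
        where
        open ℕP.≤-Reasoning
        w = walk s i (suc k)
        k+1≤L : suc k ≤ L
        k+1≤L = subst (suc k ≤_) (sym L≡2+k) (ℕP.n≤1+n (suc k))

sided : List A → List (A × Side)
sided xs = map (_, forwards) xs ++ map (_, backwards) xs

length-sided : ∀ (xs : List A) → length (sided xs) ≡ 2 * length xs
length-sided xs = begin
  length (sided xs)
    ≡⟨ length-++ (map (_, forwards) xs) ⟩
  length (map (_, forwards) xs) + length (map (_, backwards) xs)
    ≡⟨ cong₂ _+_ (length-map _ xs) (length-map _ xs) ⟩
  length xs + length xs
    ≡⟨ cong (λ m → length xs + m) (ℕP.+-identityʳ (length xs)) ⟨
  2 * length xs ∎
  where open ≡-Reasoning

∈-sided : ∀ {x} {xs : List A} s → x ∈ xs → (x , s) ∈ sided xs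
∈-sided {xs = xs} forwards  x∈ = ∈-++⁺ˡ (∈-map⁺ (_, forwards) x∈)
∈-sided {xs = xs} backwards x∈ = ∈-++⁺ʳ (map (_, forwards) xs) (∈-map⁺ (_, backwards) x∈)

-- The cells of C_{a,b}

height : Cell n → ℕ
height c = toℕ (proj₂ c)

module EdgeCells {k} (T : ClosedKnightTour (suc k)) (a b : Cell (suc k))
                 (a₀ : col a ≡ 0ℤ) (b₀ : col b ≡ 0ℤ) (b<a : height b < height a) where
  open ClosedKnightTour T

  3≤N : 3 ≤ suc k * suc k
  3≤N = ℕP.≤-trans (ℕP.n≤1+n 3) (ℕP.*-mono-≤ 2≤n 2≤n)
    where
    2≤n : 2 ≤ suc k
    2≤n = ℕP.≤-trans (s≤s (ℕP.≤-trans (s≤s z≤n) b<a)) (toℕ<n (proj₂ a))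

  open Segments T 3≤N

  visit : Cell (suc k) → Fin (suc k * suc k)
  visit c = proj₁ (surjective c)

  cell-visit : ∀ c → cell (visit c) ≡ c
  cell-visit c = proj₂ (surjective c) refl

  up down : Cell (suc k) → ℕ
  up c   = height a ∸ height c
  down c = height c ∸ height b

  edgeCells : List (Cell (suc k))
  edgeCells = filter (inC? a b) (allCells (suc k))

  edgeCells! : Unique edgeCells
  edgeCells! = Unique.filter⁺ (inC? a b) (Unique.cartesianProduct⁺ (Unique.allFin⁺ (suc k)) (Unique.allFin⁺ (suc k)))

  ∈-edgeCells⁻ : ∀ {c} → c ∈ edgeCells → InC a b c
  ∈-edgeCells⁻ c∈ = proj₂ (∈-filter⁻ (inC? a b) {xs = allCells (suc k)} c∈)

  module _ {c} (c∈C : InC a b c) where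
    on-edge : col (cell (visit c)) ≡ 0ℤ
    on-edge = trans (cong col (cell-visit c)) (proj₁ c∈C)

    height-c : height c ≡ height b + down c
    height-c = sym (ℕP.m+[n∸m]≡n (ℤP.drop‿+≤+ (proj₁ (proj₂ c∈C))))

    height-a : height a ≡ height b + down c + up c
    height-a = begin
      height a                  ≡⟨ ℕP.m+[n∸m]≡n (ℤP.drop‿+≤+ (proj₂ (proj₂ c∈C))) ⟨
      height c + up c           ≡⟨ cong (_+ up c) height-c ⟩
      height b + down c + up c  ∎
      where open ≡-Reasoning

  ShortAt : Side → Cell (suc k) → Set
  ShortAt s c = Short (heading-from s (visit c)) (segmentLength s (visit c)) (up c) (down c)

  shortAt? : ∀ s c → Dec (ShortAt s c)
  shortAt? s c = short? (heading-from s (visit c)) (segmentLength s (visit c)) (up c) (down c)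

  turnEnd : Side → Cell (suc k) → Fin (suc k * suc k)
  turnEnd s c = walk s (visit c) (segmentLength s (visit c))

  turnEnd-point : ∀ s {c} → InC a b c →
    point (cell (turnEnd s c)) ≡ ray (heading-from s (visit c)) (row b ℤ.+ + down c) (segmentLength s (visit c))
  turnEnd-point s {c} c∈C = trans (segment-point s (visit c) (on-edge c∈C) _ ℕP.≤-refl)
    (cong (λ y → ray (heading-from s (visit c)) (+ y) (segmentLength s (visit c)))
      (trans (cong height (cell-visit c)) (height-c c∈C)))

  crownTurn-at : ∀ s {c} → InC a b c → ShortAt s c → CrownTurn T a b (turnEnd s c)
  crownTurn-at s {c} c∈C short =
      segment-ends-at-turn s (visit c) (on-edge c∈C)
    , short⇒crown (heading-from s (visit c)) a₀ b₀ (cong +_ (height-a c∈C)) (turnEnd-point s c∈C) short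
    , off-edge
    where
    off-edge : col (cell (turnEnd s c)) ≢ 0ℤ
    off-edge col≡0 = ℕP.<⇒≱ (segment-length≥1 s (visit c) (on-edge c∈C)) (begin
      L                                 ≤⟨ ray-col-≥ d y L ⟩
      ∣ proj₁ (ray d y L) ∣             ≡⟨ cong (∣_∣ ∘ proj₁) (turnEnd-point s c∈C) ⟨
      ∣ col (cell (turnEnd s c)) ∣      ≡⟨ cong ∣_∣ col≡0 ⟩
      0                                 ∎)
      where
      open ℕP.≤-Reasoning
      d = heading-from s (visit c)
      y = row b ℤ.+ + down c
      L = segmentLength s (visit c)

  Good : Cell (suc k) → Set
  Good c = ShortAt forwards c ⊎ ShortAt backwards c

  good? : ∀ c → Dec (Good c)
  good? c = shortAt? forwards c ⊎-dec shortAt? backwards c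

  preferForwards : ∀ {P : Set} → Dec P → Side
  preferForwards (yes _) = forwards
  preferForwards (no _)  = backwards

  shortSide : Cell (suc k) → Side
  shortSide c = preferForwards (shortAt? forwards c)

  shortSide-short : ∀ c → Good c → ShortAt (shortSide c) c
  shortSide-short c = preferred (shortAt? forwards c)
    where
    preferred : (dec : Dec (ShortAt forwards c)) → Good c → ShortAt (preferForwards dec) c
    preferred (yes short) _            = short
    preferred (no ¬short) (inj₁ short) = ⊥-elim (¬short short)
    preferred (no _)      (inj₂ short) = short

  turnEnd-injective : ∀ s {c c′} → InC a b c → InC a b c′ → turnEnd s c ≡ turnEnd s c′ → c ≡ c′
  turnEnd-injective s {c} {c′} c∈C c′∈C w≡w′ = begin
    c                ≡⟨ cell-visit c ⟨
    cell (visit c)   ≡⟨ cong cell (walk-injective s L (trans w≡w′ (cong (walk s (visit c′)) (sym L≡L′)))) ⟩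
    cell (visit c′)  ≡⟨ cell-visit c′ ⟩
    c′               ∎
    where
    open ≡-Reasoning
    d  = heading-from s (visit c)
    d′ = heading-from s (visit c′)
    L  = segmentLength s (visit c)
    L′ = segmentLength s (visit c′)
    w  = turnEnd s c
    arrival : Step (along d) (cell (retreat s w)) (cell w)
    arrival = segment-arrival s (visit c) (on-edge c∈C) L (segment-length≥1 s (visit c) (on-edge c∈C)) ℕP.≤-refl
    arrival′ : Step (along d′) (cell (retreat s w)) (cell w)
    arrival′ = subst (λ x → Step (along d′) (cell (retreat s x)) (cell x)) (sym w≡w′)
      (segment-arrival s (visit c′) (on-edge c′∈C) L′ (segment-length≥1 s (visit c′) (on-edge c′∈C)) ℕP.≤-refl)
    d≡d′ : d ≡ d′
    d≡d′ = along-injective (step-unique arrival arrival′)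
    L≡L′ : L ≡ L′
    L≡L′ = ray-col-injective d {row b ℤ.+ + down c} {row b ℤ.+ + down c′} (cong proj₁ (begin
      ray d (row b ℤ.+ + down c) L      ≡⟨ turnEnd-point s c∈C ⟨
      point (cell w)                    ≡⟨ cong (point ∘ cell) w≡w′ ⟩
      point (cell (turnEnd s c′))       ≡⟨ turnEnd-point s c′∈C ⟩
      ray d′ (row b ℤ.+ + down c′) L′   ≡⟨ cong (λ e → ray e (row b ℤ.+ + down c′) L′) d≡d′ ⟨
      ray d (row b ℤ.+ + down c′) L′    ∎))

  goodCells badCells : List (Cell (suc k))
  goodCells = filter good? edgeCells
  badCells  = filter (¬? ∘ good?) edgeCells

  crownTurns : List (Fin (suc k * suc k))
  crownTurns = filter (crownTurn? T a b) (allFin (suc k * suc k))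

  good-count : length goodCells ≤ 2 * numCrownTurns T a b
  good-count = subst (length goodCells ≤_) (length-sided crownTurns)
    (length-≤-by-injection end (Unique.filter⁺ good? edgeCells!) end∈ end-injective)
    where
    end : Cell (suc k) → Fin (suc k * suc k) × Side
    end c = turnEnd (shortSide c) c , shortSide c
    inEdge : ∀ {c} → c ∈ goodCells → InC a b c
    inEdge c∈ = ∈-edgeCells⁻ (proj₁ (∈-filter⁻ good? {xs = edgeCells} c∈))
    end∈ : ∀ {c} → c ∈ goodCells → end c ∈ sided crownTurns
    end∈ {c} c∈ = ∈-sided (shortSide c) (∈-filter⁺ (crownTurn? T a b) (∈-allFin _)
      (crownTurn-at (shortSide c) (inEdge c∈) (shortSide-short c (proj₂ (∈-filter⁻ good? {xs = edgeCells} c∈)))))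
    end-injective : ∀ {c c′} → c ∈ goodCells → c′ ∈ goodCells → end c ≡ end c′ → c ≡ c′
    end-injective {c} {c′} c∈ c′∈ e = turnEnd-injective (shortSide c) (inEdge c∈) (inEdge c′∈)
      (trans (cong proj₁ e) (cong (λ s → turnEnd s c′) (sym (cong proj₂ e))))

  first-step : ∀ s {c} → InC a b c → Step (along (heading-from s (visit c))) (cell (visit c)) (cell (advance s (visit c)))
  first-step s {c} c∈C = segment-step s (visit c) (on-edge c∈C) 0 (segment-length≥1 s (visit c) (on-edge c∈C))

  headings-differ : ∀ {c} → InC a b c → heading-from forwards (visit c) ≢ heading-from backwards (visit c)
  headings-differ {c} c∈C same = ends-differ forwards (visit c) (step-deterministic (first-step forwards c∈C)
    (subst (λ d → Step (along d) (cell (visit c)) (cell (prev (visit c)))) (sym same) (first-step backwards c∈C)))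

  pairAt : Cell (suc k) → DirPair
  pairAt c = pairOf (heading-from forwards (visit c)) (heading-from backwards (visit c))

  SideHeading : Cell (suc k) → Dir → Set
  SideHeading c d = Σ Side λ s → heading-from s (visit c) ≡ d

  sideWith : ∀ {c d} → d ≡ heading-from forwards (visit c) ⊎ d ≡ heading-from backwards (visit c) → SideHeading c d
  sideWith (inj₁ d≡) = forwards , sym d≡
  sideWith (inj₂ d≡) = backwards , sym d≡

  lowerSide : ∀ {c} → InC a b c → SideHeading c (lower (pairAt c))
  lowerSide c∈C = sideWith (sorted-lower (pairOf-sorted _ _ (headings-differ c∈C)))

  upperSide : ∀ {c} → InC a b c → SideHeading c (upper (pairAt c))
  upperSide c∈C = sideWith (Sum.swap (sorted-upper (pairOf-sorted _ _ (headings-differ c∈C))))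

  module _ {c c′} (c∈C : InC a b c) (c′∈C : InC a b c′) {g} (c′≡ : height c′ ≡ height c + g) where
    down-apart : down c′ ≡ g + down c
    down-apart = ℕP.+-cancelˡ-≡ (height b) _ _ (begin
      height b + down c′          ≡⟨ height-c c′∈C ⟨
      height c′                   ≡⟨ c′≡ ⟩
      height c + g                ≡⟨ cong (_+ g) (height-c c∈C) ⟩
      height b + down c + g       ≡⟨ ℕP.+-assoc (height b) (down c) g ⟩
      height b + (down c + g)     ≡⟨ cong (λ x → height b + x) (ℕP.+-comm (down c) g) ⟩
      height b + (g + down c)     ∎)
      where open ≡-Reasoning

    up-apart : up c ≡ g + up c′
    up-apart = ℕP.+-cancelˡ-≡ (height b + down c) _ _ (begin
      height b + down c + up c          ≡⟨ height-a c∈C ⟨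
      height a                          ≡⟨ height-a c′∈C ⟩
      height b + down c′ + up c′        ≡⟨ cong (λ x → height b + x + up c′) down-apart ⟩
      height b + (g + down c) + up c′   ≡⟨ regroup (height b) g (down c) (up c′) ⟩
      height b + down c + (g + up c′)   ∎)
      where
      open ≡-Reasoning
      regroup : ∀ h g d u → h + (g + d) + u ≡ h + d + (g + u)
      regroup = ℕ-solve-∀

  -- The lower cell's segment in direction lower pr and the upper cell's segment in
  -- direction upper pr, both too long to be Short, meet inside the former: the tour
  -- would pass through that cell in two directions.
  segments-cannot-cross : ∀ pr {c c′ s s′ q} → InC a b c → InC a b c′ →
    heading-from s (visit c) ≡ lower pr → heading-from s′ (visit c′) ≡ upper pr →
    ¬ ShortAt s c → ¬ ShortAt s′ c′ → 1 ≤ q → height c′ ≡ height c + pairPeriod pr * q → ⊥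
  segments-cannot-cross pr {c} {c′} {s} {s′} {q} c∈C c′∈C d≡ d′≡ long long′ 1≤q c′≡ =
    lower≢upper pr (trans (sym d≡) (trans (arrival-direction s s′ w arrival leaving arrival′) d′≡))
    where
    open Crossing (crossing pr)
    i  = visit c
    i′ = visit c′
    L  = segmentLength s i
    L′ = segmentLength s′ i′
    bounds = meeting-within-segments (crossing pr) {q} {L} {L′} {up c′} {down c} 1≤q
      (subst₂ (λ d u → ¬ Short d L u (down c)) d≡ (up-apart {c} {c′} c∈C c′∈C c′≡) long)
      (subst₂ (λ d v → ¬ Short d L′ (up c′) v) d′≡ (down-apart {c} {c′} c∈C c′∈C c′≡) long′)
    t  = lowerSteps * q
    t′ = upperSteps * q
    t<L : t < L
    t<L = proj₁ (proj₂ bounds)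
    w  = walk s i t
    w′ = walk s′ i′ t′
    same-point : point (cell w) ≡ point (cell w′)
    same-point = begin
      point (cell w)                                 ≡⟨ segment-point s i (on-edge c∈C) t (ℕP.<⇒≤ t<L) ⟩
      ray (heading-from s i) (row (cell i)) t        ≡⟨ cong₂ (λ d x → ray d (row x) t) d≡ (cell-visit c) ⟩
      ray (lower pr) (row c) t                       ≡⟨ rays-meet (crossing pr) (row c) q ⟩
      ray (upper pr) (row c ℤ.+ + (period * q)) t′   ≡⟨ cong (λ y → ray (upper pr) (+ y) t′) c′≡ ⟨
      ray (upper pr) (row c′) t′                     ≡⟨ cong₂ (λ d x → ray d (row x) t′) d′≡ (cell-visit c′) ⟨
      ray (heading-from s′ i′) (row (cell i′)) t′    ≡⟨ segment-point s′ i′ (on-edge c′∈C) t′ (proj₂ (proj₂ (proj₂ bounds))) ⟨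
      point (cell w′)                                ∎
      where open ≡-Reasoning
    w≡w′ : w ≡ w′
    w≡w′ = injective (cell-≡ (cong proj₁ same-point) (cong proj₂ same-point))
    arrival : Step (along (heading-from s i)) (cell (retreat s w)) (cell w)
    arrival = segment-arrival s i (on-edge c∈C) t (proj₁ bounds) (ℕP.<⇒≤ t<L)
    leaving : Step (along (heading-from s i)) (cell w) (cell (advance s w))
    leaving = segment-step s i (on-edge c∈C) t t<L
    arrival′ : Step (along (heading-from s′ i′)) (cell (retreat s′ w)) (cell w)
    arrival′ = subst (λ x → Step (along (heading-from s′ i′)) (cell (retreat s′ x)) (cell x)) (sym w≡w′)
      (segment-arrival s′ i′ (on-edge c′∈C) t′ (proj₁ (proj₂ (proj₂ bounds))) (proj₂ (proj₂ (proj₂ bounds))))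

  not-short : ∀ s {c} → ¬ Good c → ¬ ShortAt s c
  not-short forwards  bad short = bad (inj₁ short)
  not-short backwards bad short = bad (inj₂ short)

  residueCode : Cell (suc k) → DirPair × ℕ
  residueCode c = pairAt c , residue (pairAt c) (height c)

  residue-collision : ∀ {c c′} → InC a b c → InC a b c′ → ¬ Good c → ¬ Good c′ →
    residueCode c ≡ residueCode c′ → height c < height c′ → ⊥
  residue-collision {c} {c′} c∈C c′∈C bad bad′ same c<c′ =
    segments-cannot-cross pr c∈C c′∈C lower-heading upper-heading
      (not-short (proj₁ (lowerSide c∈C)) bad) (not-short (proj₁ (upperSide c′∈C)) bad′)
      (proj₁ (proj₂ apart)) (proj₂ (proj₂ apart))
    where
    pr = pairAt c
    pr≡ : pairAt c′ ≡ pr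
    pr≡ = sym (cong proj₁ same)
    apart = same-residue⇒apart pr (trans (cong proj₂ same) (cong (λ p → residue p (height c′)) pr≡)) c<c′
    lower-heading : heading-from (proj₁ (lowerSide c∈C)) (visit c) ≡ lower pr
    lower-heading = proj₂ (lowerSide c∈C)
    upper-heading : heading-from (proj₁ (upperSide c′∈C)) (visit c′) ≡ upper pr
    upper-heading = trans (proj₂ (upperSide c′∈C)) (cong upper pr≡)

  bad-count : length badCells ≤ length residueCodes
  bad-count = length-≤-by-injection residueCode (Unique.filter⁺ (¬? ∘ good?) edgeCells!) code∈ code-injective
    where
    bad-edge : ∀ {c} → c ∈ badCells → InC a b c × ¬ Good c
    bad-edge c∈ = map₁ ∈-edgeCells⁻ (∈-filter⁻ (¬? ∘ good?) {xs = edgeCells} c∈)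
    code∈ : ∀ {c} → c ∈ badCells → residueCode c ∈ residueCodes
    code∈ {c} _ = ∈-residueCodes (pairAt c) (residue< (pairAt c) (height c))
    by-height : ∀ {c c′} → InC a b c → InC a b c′ → ¬ Good c → ¬ Good c′ → residueCode c ≡ residueCode c′ →
      Tri (height c < height c′) (height c ≡ height c′) (height c′ < height c) → c ≡ c′
    by-height c∈C c′∈C bad bad′ same (tri< c<c′ _ _) = ⊥-elim (residue-collision c∈C c′∈C bad bad′ same c<c′)
    by-height c∈C c′∈C bad bad′ same (tri> _ _ c′<c) = ⊥-elim (residue-collision c′∈C c∈C bad′ bad (sym same) c′<c)
    by-height c∈C c′∈C _   _    _    (tri≈ _ h≡h′ _) = cell-≡ (trans (proj₁ c∈C) (sym (proj₁ c′∈C))) (cong +_ h≡h′)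
    code-injective : ∀ {c c′} → c ∈ badCells → c′ ∈ badCells → residueCode c ≡ residueCode c′ → c ≡ c′
    code-injective {c} {c′} c∈ c′∈ same =
      by-height (proj₁ (bad-edge c∈)) (proj₁ (bad-edge c′∈)) (proj₂ (bad-edge c∈)) (proj₂ (bad-edge c′∈)) same
        (ℕP.<-cmp (height c) (height c′))

  edge-count : sizeC a b ≤ 2 * numCrownTurns T a b + 22
  edge-count = begin
    length edgeCells                               ≡⟨ length-filter-partition good? edgeCells ⟩
    length goodCells + length badCells             ≤⟨ ℕP.+-mono-≤ good-count bad-count ⟩
    2 * numCrownTurns T a b + length residueCodes  ≡⟨ cong (λ r → 2 * numCrownTurns T a b + r) length-residueCodes ⟩
    2 * numCrownTurns T a b + 22                   ∎
    where open ℕP.≤-Reasoning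

mainTheorem3 : (n : ℕ) (T : ClosedKnightTour n) (a b : Cell n) →
    toℕ (proj₁ a) ≡ 0 → toℕ (proj₁ b) ≡ 0 →
    toℕ (proj₂ b) < toℕ (proj₂ a) →
    122 ≤ sizeC a b →
    sizeC a b ∸ 122 ≤ 2 * numCrownTurns T a b
mainTheorem3 zero    T (() , _) b _  _  _   _
mainTheorem3 (suc k) T a        b a₀ b₀ b<a _ = ℕP.m≤n+o⇒m∸n≤o (sizeC a b) 122 (begin
  sizeC a b                     ≤⟨ edge-count ⟩
  2 * numCrownTurns T a b + 22  ≤⟨ ℕP.+-monoʳ-≤ (2 * numCrownTurns T a b) (ℕP.≤ᵇ⇒≤ 22 122 _) ⟩
  2 * numCrownTurns T a b + 122 ≡⟨ ℕP.+-comm (2 * numCrownTurns T a b) 122 ⟩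
  122 + 2 * numCrownTurns T a b ∎)
  where
  open ℕP.≤-Reasoning
  open EdgeCells T a b (cong +_ a₀) (cong +_ b₀) b<a
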